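{- Let $\phi\in\mathsf{InqML}$ and let $\phi^*(\lambda)$ be its standard translation. Let $\mathcal M=(W,\Sigma,V)$ be a pseudo-model (or model), $s\subseteq W$, and let $(\mathfrak M,s)$ be a relational representation of $(\mathcal M,s)$. Then $\mathcal M,s\models\phi$ if and only if $\mathfrak M\models\phi^*(\lambda)$ with $\lambda$ interpreted as $s$.
   Context: Fix propositional variables $(p_i)_{i\in I}$. A pseudo-model is $\mathcal M=(W,\Sigma,V)$ with $W\neq\emptyset$, $\Sigma\colon W\to\mathcal P(\mathcal P(W))\setminus\{\emptyset\}$, $V\colon\{p_i\}\to\mathcal P(W)$; it is a model if each $\Sigma(w)$ is closed under subsets. Put $\sigma(w)=\bigcup\Sigma(w)$. $\mathsf{InqML}$: $\phi::=p_i\mid\bot\mid(\phi\wedge\phi)\mid(\phi\to\phi)\mid(\phi\mathbin{\backslash\!/}\phi)\mid\Box\phi\mid\boxplus\phi$, with support semantics on $s\subseteq W$: $\mathcal M,s\models p_i$ iff $s\subseteq V(p_i)$; $\mathcal M,s\models\bot$ iff $s=\emptyset$; $\wedge$ componentwise; $\mathcal M,s\models\phi\to\psi$ iff for all $t\subseteq s$, $\mathcal M,t\models\phi\Rightarrow\mathcal M,t\models\psi$; $\mathcal M,s\models\phi\mathbin{\backslash\!/}\psi$ iff $\mathcal M,s\models\phi$ or $\mathcal M,s\models\psi$; $\mathcal M,s\models\Box\phi$ iff $\mathcal M,\sigma(w)\models\phi$ for all $w\in s$; $\mathcal M,s\models\boxplus\phi$ iff $\mathcal M,t\models\phi$ for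 all $w\in s$, $t\in\Sigma(w)$. Relational pseudo-models are two-sorted structures $\mathfrak M=(W,S,\epsilon,E,(P_i)_{i\in I})$, $W,S\neq\emptyset$, $\epsilon,E\subseteq W\times S$, $P_i\subseteq W$, such that $\underline s=\underline t\Rightarrow s=t$ (where $\underline s=\{w:(w,s)\in\epsilon\}$) and $E[w]=\{s:(w,s)\in E\}\neq\emptyset$ for all $w$; one identifies $S$ with a subset of $\mathcal P(W)$ and $\epsilon$ with membership. A relational representation of $(\mathcal M,s)$ is a relational pseudo-model with the same $W$, with $S\subseteq\mathcal P(W)$ containing $s$ and all members of all $\Sigma(w)$, $\epsilon$ the membership relation, $E=\{(w,t):t\in\Sigma(w)\}$, $P_i=V(p_i)$. Flatness grade: $\mathrm{fl}=0$ for $p_i,\bot,\Box\psi,\boxplus\psi$; $\mathrm{fl}(\psi\wedge\chi)=\max(\mathrm{fl}\psi,\mathrm{fl}\chi)$; $\mathrm{fl}(\psi\to\chi)=\mathrm{fl}(\chi)$; $\mathrm{fl}(\psi\mathbin{\backslash\!/}\chi)=\mathrm{fl}(\psi)+\mathrm{fl}(\chi)+1$. Standard translation: variables $x,y$ range over the first sort, $\lambda,\mu$ over the second; $x\in\lambda$ abbreviates $\epsilon x\lambda$. For a tuple $\mathbf x=(x_1,\dots,x_n)$ ($n\ge1$) define $\mathrm{ST}(\xi,\mathbf x)$: $\mathrm{ST}(p_i,\mathbf x)=\bigwedge_{k\le n}P_ix_k$; $\mathrm{ST}(\bot,\mathbf x)=\bigwedge_{k\le n}\neg x_k=x_k$;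 $\mathrm{ST}(\psi\wedge\chi,\mathbf x)=\mathrm{ST}(\psi,\mathbf x)\wedge\mathrm{ST}(\chi,\mathbf x)$; $\mathrm{ST}(\psi\to\chi,\mathbf x)=\forall y_1\dots\forall y_n[(\bigwedge_{k\le n}\bigvee_{l\le n}y_k=x_l)\to(\mathrm{ST}(\psi,\mathbf y)\to\mathrm{ST}(\chi,\mathbf y))]$; $\mathrm{ST}(\psi\mathbin{\backslash\!/}\chi,\mathbf x)=\mathrm{ST}(\psi,\mathbf x)\vee\mathrm{ST}(\chi,\mathbf x)$; with $m=\mathrm{fl}(\psi)+1$, $\mathrm{ST}(\Box\psi,\mathbf x)=\bigwedge_{k\le n}\forall y_1..y_m\forall\mu_1..\mu_m(\bigwedge_{l\le m}(Ex_k\mu_l\wedge y_l\in\mu_l)\to\mathrm{ST}(\psi,(y_1,..,y_m)))$; $\mathrm{ST}(\boxplus\psi,\mathbf x)=\bigwedge_{k\le n}\forall\mu(Ex_k\mu\to\psi^*(\mu))$. Finally, with $m=\mathrm{fl}(\phi)+1$, $\phi^*(\lambda):=\forall x_1..x_m(\bigwedge_{k\le m}x_k\in\lambda\to\mathrm{ST}(\phi,(x_1,..,x_m)))$ (fresh variables used throughout). -}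

module Defs where

open import Data.Bool using (Bool; true; false; T)
open import Data.Nat using (ℕ; zero; suc; _+_; _⊔_)
open import Data.List using (List; []; _∷_; replicate; _++_)
open import Data.Vec using (Vec; []; _∷_; map; zipWith)
open import Data.Product using (Σ; ∃; _×_; _,_)
open import Data.Sum using (_⊎_)
open import Relation.Nullary using (¬_; Dec; does)
open import Relation.Binary.PropositionalEquality using (_≡_)
open import Function.Bundles using (_⇔_)

-- Classical background.  Subsets of W are decidable (Bool-valued)
-- predicates; the paper works classically, and the excluded middle is
-- supplied as an explicit hypothesis.

LEM : Set₁
LEM = (P : Set) → Dec P

Subset : Set → Set
Subset W = W → Bool

_⊆_ : {W : Set} → Subset W → Subset W → Set
s ⊆ t = ∀ w → T (s w) → T (t w)

infixr 6 _∧'_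
infixr 5 _⩔_
infixr 4 _⇒'_

data Fm (I : Set) : Set where
  var  : I → Fm I
  ⊥'   : Fm I
  _∧'_ : Fm I → Fm I → Fm I
  _⇒'_ : Fm I → Fm I → Fm I
  _⩔_  : Fm I → Fm I → Fm I
  □    : Fm I → Fm I
  ⊞    : Fm I → Fm I

fl : {I : Set} → Fm I → ℕ
fl (var i)  = 0
fl ⊥'       = 0
fl (φ ∧' ψ) = fl φ ⊔ fl ψ
fl (φ ⇒' ψ) = fl ψ
fl (φ ⩔ ψ)  = fl φ + fl ψ + 1
fl (□ φ)    = 0
fl (⊞ φ)    = 0

record PseudoModel (I W : Set) : Set₁ where
  field
    W-ne : W
    Σₘ   : W → Subset W → Set
    Σ-ne : ∀ w → ∃ λ t → Σₘ w t
    V    : I → Subset W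

-- model: each Σ(w) closed under subsets (not needed for the statement)
IsModel : {I W : Set} → PseudoModel I W → Set
IsModel {W = W} M = ∀ w (t u : Subset W) → Σₘ w t → u ⊆ t → Σₘ w u
  where open PseudoModel M

σ : {I W : Set} → LEM → PseudoModel I W → W → Subset W
σ lem M w x = does (lem (∃ λ t → Σₘ w t × T (t x)))
  where open PseudoModel M

sup : {I W : Set} → LEM → PseudoModel I W → Subset W → Fm I → Set
sup lem M s (var i)  = ∀ w → T (s w) → T (PseudoModel.V M i w)
sup lem M s ⊥'       = ∀ w → ¬ T (s w)
sup lem M s (φ ∧' ψ) = sup lem M s φ × sup lem M s ψ
sup lem M s (φ ⇒' ψ) = ∀ t → t ⊆ s → sup lem M t φ → sup lem M t ψ
sup lem M s (φ ⩔ ψ)  = sup lem M s φ ⊎ sup lem M s ψ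
sup lem M s (□ φ)    = ∀ w → T (s w) → sup lem M (σ lem M w) φ
sup lem M s (⊞ φ)    = ∀ w → T (s w) → ∀ t → PseudoModel.Σₘ M w t → sup lem M t φ

-- Two-sorted first-order logic (de Bruijn variables; "fresh" variables
-- are new binders)

data Sort : Set where
  𝕨 𝕤 : Sort

Ctx : Set
Ctx = List Sort

data Var : Ctx → Sort → Set where
  vz : ∀ {Γ σ} → Var (σ ∷ Γ) σ
  vs : ∀ {Γ σ τ} → Var Γ σ → Var (τ ∷ Γ) σ

infixr 6 _∧̇_
infixr 5 _∨̇_
infixr 4 _→̇_

data FO (I : Set) (Γ : Ctx) : Set where
  _≐_  : Var Γ 𝕨 → Var Γ 𝕨 → FO I Γ
  _∈̇_  : Var Γ 𝕨 → Var Γ 𝕤 → FO I Γ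
  Ė    : Var Γ 𝕨 → Var Γ 𝕤 → FO I Γ
  Ṗ    : I → Var Γ 𝕨 → FO I Γ
  ¬̇_   : FO I Γ → FO I Γ
  _∧̇_  : FO I Γ → FO I Γ → FO I Γ
  _∨̇_  : FO I Γ → FO I Γ → FO I Γ
  _→̇_  : FO I Γ → FO I Γ → FO I Γ
  ∀̇    : (τ : Sort) → FO I (τ ∷ Γ) → FO I Γ

⋀ : ∀ {I Γ n} → Vec (FO I Γ) (suc n) → FO I Γ
⋀ (φ ∷ [])     = φ
⋀ (φ ∷ ψ ∷ φs) = φ ∧̇ ⋀ (ψ ∷ φs)

⋁ : ∀ {I Γ n} → Vec (FO I Γ) (suc n) → FO I Γ
⋁ (φ ∷ [])     = φ
⋁ (φ ∷ ψ ∷ φs) = φ ∨̇ ⋁ (ψ ∷ φs)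

wkN : ∀ {Γ σ} (k : ℕ) (τ : Sort) → Var Γ σ → Var (replicate k τ ++ Γ) σ
wkN zero    τ x = x
wkN (suc k) τ x = vs (wkN k τ x)

fresh : ∀ {Γ} (k : ℕ) (τ : Sort) → Vec (Var (replicate k τ ++ Γ) τ) k
fresh zero    τ = []
fresh (suc k) τ = vz ∷ map vs (fresh k τ)

∀̇ⁿ : ∀ {I Γ} (k : ℕ) (τ : Sort) → FO I (replicate k τ ++ Γ) → FO I Γ
∀̇ⁿ zero    τ φ = φ
∀̇ⁿ (suc k) τ φ = ∀̇ⁿ k τ (∀̇ τ φ)

mutual
  ST : ∀ {I Γ n} → Fm I → Vec (Var Γ 𝕨) (suc n) → FO I Γ
  ST (var i)  xs = ⋀ (map (Ṗ i) xs)
  ST ⊥'       xs = ⋀ (map (λ x → ¬̇ (x ≐ x)) xs)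
  ST (φ ∧' ψ) xs = ST φ xs ∧̇ ST ψ xs
  ST {n = n} (φ ⇒' ψ) xs =
    ∀̇ⁿ (suc n) 𝕨
      (⋀ (map (λ y → ⋁ (map (λ x → y ≐ wkN (suc n) 𝕨 x) xs)) ys)
        →̇ (ST φ ys →̇ ST ψ ys))
    where ys = fresh (suc n) 𝕨
  ST (φ ⩔ ψ)  xs = ST φ xs ∨̇ ST ψ xs
  ST (□ φ)    xs = ⋀ (map box xs)
    where
      m = suc (fl φ)
      box : _ → _
      box x =
        ∀̇ⁿ m 𝕨 (∀̇ⁿ m 𝕤
          (⋀ (zipWith (λ y μ → Ė (wkN m 𝕤 (wkN m 𝕨 x)) μ ∧̇ (y ∈̇ μ))
                      (map (wkN m 𝕤) (fresh m 𝕨)) (fresh m 𝕤))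
            →̇ ST φ (map (wkN m 𝕤) (fresh m 𝕨))))
  ST (⊞ φ)    xs = ⋀ (map (λ x → ∀̇ 𝕤 (Ė (vs x) vz →̇ star φ vz)) xs)

  star : ∀ {I Γ} → Fm I → Var Γ 𝕤 → FO I Γ
  star φ l = ∀̇ⁿ m 𝕨 (⋀ (map (λ x → x ∈̇ wkN m 𝕨 l) xs) →̇ ST φ xs)
    where
      m  = suc (fl φ)
      xs = fresh m 𝕨

record RelModel (I W : Set) : Set₁ where
  field
    W-ne : W
    S    : Set
    S-ne : S
    ε    : W → S → Set
    E    : W → S → Set
    P    : I → W → Set
    ext  : ∀ a b → (∀ w → ε w a ⇔ ε w b) → a ≡ b
    E-ne : ∀ w → ∃ λ a → E w a

module _ {I W : Set} (𝔐 : RelModel I W) where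
  open RelModel 𝔐

  Dom : Sort → Set
  Dom 𝕨 = W
  Dom 𝕤 = S

  Env : Ctx → Set
  Env Γ = ∀ {τ} → Var Γ τ → Dom τ

  _▸_ : ∀ {Γ τ} → Env Γ → Dom τ → Env (τ ∷ Γ)
  (ρ ▸ d) vz     = d
  (ρ ▸ d) (vs x) = ρ x

  ⟦_⟧ : ∀ {Γ} → FO I Γ → Env Γ → Set
  ⟦ x ≐ y ⟧  ρ = ρ x ≡ ρ y
  ⟦ x ∈̇ l ⟧  ρ = ε (ρ x) (ρ l)
  ⟦ Ė x l ⟧  ρ = E (ρ x) (ρ l)
  ⟦ Ṗ i x ⟧  ρ = P i (ρ x)
  ⟦ ¬̇ φ ⟧    ρ = ¬ ⟦ φ ⟧ ρ
  ⟦ φ ∧̇ ψ ⟧  ρ = ⟦ φ ⟧ ρ × ⟦ ψ ⟧ ρ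
  ⟦ φ ∨̇ ψ ⟧  ρ = ⟦ φ ⟧ ρ ⊎ ⟦ ψ ⟧ ρ
  ⟦ φ →̇ ψ ⟧  ρ = ⟦ φ ⟧ ρ → ⟦ ψ ⟧ ρ
  ⟦ ∀̇ τ φ ⟧  ρ = (d : Dom τ) → ⟦ φ ⟧ (ρ ▸ d)

  [λ↦_] : S → Env (𝕤 ∷ [])
  [λ↦ a ] vz = a
  [λ↦ a ] (vs ())

-- (𝔐, s) is a relational representation of (M, s):
-- S is identified with a subset of P(W) via `code`, containing s and
-- every member of every Σ(w); ε is membership, E = {(w,t) : t ∈ Σ(w)},
-- P_i = V(p_i).

record Representation {I W : Set} (M : PseudoModel I W) (s : Subset W)
                      (𝔐 : RelModel I W) : Set₁ where
  open PseudoModel M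
  open RelModel 𝔐
  field
    code   : S → Subset W
    ε-code : ∀ w a → ε w a ⇔ T (code a w)
    E-code : ∀ w a → E w a ⇔ Σₘ w (code a)
    P-code : ∀ i w → P i w ⇔ T (V i w)
    s∈S    : ∃ λ a → code a ≡ s
    Σ⊆S    : ∀ w t → Σₘ w t → ∃ λ a → code a ≡ t

module Submission where

-- Support is persistent and trivial on the empty state, and a formula of
-- flatness grade f is (f+1)-coherent: a state supports it as soon as each of
-- its subsets with at most f+1 elements does (classically, counterexamples to
-- the two disjuncts of a ⩔ merge, so the bounds add up).  By induction on φ,
-- ST(φ, x₁…xₙ) then expresses that the set {x₁,…,xₙ} supports φ: the guard of
-- → makes the quantified n-tuples range over the nonempty substates, and □, ⊞
-- reach the states of Σ(w) through E and ε because the representation contains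
-- all of them.  Finally φ*(λ) says that every (fl φ+1)-element subset of λ
-- supports φ, which by coherence means that λ does.

open import Defs
open import Data.Bool using (true; false; T; if_then_else_)
open import Data.Empty using (⊥-elim)
open import Data.List using (replicate; _++_)
open import Data.Nat using (ℕ; suc; _+_; _≤_; _≤′_; ≤′-refl; ≤′-step)
open import Data.Nat.Properties using (m≤m⊔n; m≤n⊔m; +-suc; +-comm; ≤⇒≤′)
open import Data.Product using (∃; _×_; _,_; proj₁; proj₂; uncurry)
open import Data.Product.Function.NonDependent.Propositional using (_×-⇔_)
open import Data.Sum using (inj₁; inj₂; [_,_]′)
open import Data.Sum.Function.Propositional using (_⊎-⇔_)
open import Data.Unit using (tt)
open import Data.Vec using (Vec; []; _∷_; map; zipWith) renaming (_++_ to _++ᵛ_)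
open import Data.Vec.Properties using (map-∘; map-cong)
open import Data.Vec.Membership.Propositional using (_∈_)
open import Data.Vec.Membership.Propositional.Properties using (∈-map⁺; ∈-++⁺ˡ; ∈-++⁺ʳ)
open import Data.Vec.Relation.Unary.All as All using (All; []; _∷_)
import Data.Vec.Relation.Unary.All.Properties as Allₚ
open import Data.Vec.Relation.Unary.Any as Any using (Any; here; there)
import Data.Vec.Relation.Unary.Any.Properties as Anyₚ
open import Data.Vec.Relation.Binary.Pointwise.Inductive using (Pointwise; []; _∷_)
open import Function using (_∘_)
open import Function.Bundles using (_⇔_; mk⇔; Equivalence)
open import Function.Construct.Symmetry using (⇔-sym)
open import Function.Properties.Equivalence using () renaming (trans to ⇔-trans)
open import Function.Related.TypeIsomorphisms using (→-cong-⇔)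
open import Relation.Binary.PropositionalEquality using (_≡_; refl; sym; trans; cong; cong₂; subst)
open import Relation.Nullary using (¬_; Dec; yes; no; does)
open import Relation.Nullary.Decidable using (decidable-stable)

open Equivalence

T-does : {P : Set} (d : Dec P) → T (does d) ⇔ P
T-does (yes p) = mk⇔ (λ _ → p) (λ _ → tt)
T-does (no ¬p) = mk⇔ (λ ()) ¬p

Π-⇔ : {A : Set} {B C : A → Set} → (∀ a → B a ⇔ C a) → (∀ a → B a) ⇔ (∀ a → C a)
Π-⇔ h = mk⇔ (λ f a → to (h a) (f a)) (λ g a → from (h a) (g a))

All-⇔ : {A : Set} {P Q : A → Set} {k : ℕ} {xs : Vec A k} → (∀ x → P x ⇔ Q x) → All P xs ⇔ All Q xs
All-⇔ h = mk⇔ (All.map (to (h _))) (All.map (from (h _)))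

Any-⇔ : {A : Set} {P Q : A → Set} {k : ℕ} {xs : Vec A k} → (∀ x → P x ⇔ Q x) → Any P xs ⇔ Any Q xs
Any-⇔ h = mk⇔ (Any.map (to (h _))) (Any.map (from (h _)))

All-map⇔ : {A B : Set} {P : B → Set} {f : A → B} {k : ℕ} {xs : Vec A k} → All P (map f xs) ⇔ All (P ∘ f) xs
All-map⇔ = mk⇔ Allₚ.map⁻ Allₚ.map⁺

Any-map⇔ : {A B : Set} {P : B → Set} {f : A → B} {k : ℕ} {xs : Vec A k} → Any P (map f xs) ⇔ Any (P ∘ f) xs
Any-map⇔ = mk⇔ Anyₚ.map⁻ Anyₚ.map⁺

All⇔∀∈ : {A : Set} {P : A → Set} {k : ℕ} {xs : Vec A k} → All P xs ⇔ (∀ {x} → x ∈ xs → P x)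
All⇔∀∈ {xs = xs} = mk⇔ All.lookup (tabulate xs)
  where
    tabulate : ∀ {A P k} (xs : Vec A k) → (∀ {x} → x ∈ xs → P x) → All P xs
    tabulate []       h = []
    tabulate (x ∷ xs) h = h (here refl) ∷ tabulate xs (λ p → h (there p))

All-∃⇔∃-Pointwise : {A B : Set} {R : A → B → Set} {k : ℕ} {xs : Vec A k} →
  All (λ x → ∃ (R x)) xs ⇔ ∃ λ ys → Pointwise R xs ys
All-∃⇔∃-Pointwise = mk⇔ choose forget
  where
    choose : ∀ {A B R k} {xs : Vec A k} → All (λ x → ∃ (R x)) xs → ∃ λ (ys : Vec B k) → Pointwise R xs ys
    choose []             = [] , []
    choose ((y , r) ∷ rs) with choose rs
    ... | ys , rs′ = y ∷ ys , r ∷ rs′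
    forget : ∀ {A B R k} {xs : Vec A k} → (∃ λ (ys : Vec B k) → Pointwise R xs ys) → All (λ x → ∃ (R x)) xs
    forget (_ , [])     = []
    forget (_ , r ∷ rs) = (_ , r) ∷ forget (_ , rs)

⊆-refl : {W : Set} {s : Subset W} → s ⊆ s
⊆-refl _ p = p

⊆-trans : {W : Set} {s t u : Subset W} → s ⊆ t → t ⊆ u → s ⊆ u
⊆-trans s⊆t t⊆u w p = t⊆u w (s⊆t w p)

module TupleSets (lem : LEM) {W : Set} where

  setOf : ∀ {k} → Vec W k → Subset W
  setOf ys w = does (lem (w ∈ ys))

  ∈-setOf : ∀ {k w} {ys : Vec W k} → T (setOf ys w) ⇔ w ∈ ys
  ∈-setOf = T-does (lem _)

  setOf-mono : ∀ {k l} {ys : Vec W k} {zs : Vec W l} → (∀ {w} → w ∈ ys → w ∈ zs) → setOf ys ⊆ setOf zs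
  setOf-mono h w p = from ∈-setOf (h (to ∈-setOf p))

  All⇔∀setOf : ∀ {k} {P : W → Set} {ys : Vec W k} → All P ys ⇔ (∀ w → T (setOf ys w) → P w)
  All⇔∀setOf = ⇔-trans All⇔∀∈ (mk⇔ (λ h w p → h (to ∈-setOf p)) (λ h {w} p → h w (from ∈-setOf p)))

  -- Replace the values outside t by a fixed w₀ ∈ t.
  ⊆setOf⇒setOf : ∀ {k} {t : Subset W} {w₀} (ys : Vec W k) → T (t w₀) → t ⊆ setOf ys →
    ∃ λ (zs : Vec W k) → setOf zs ⊆ t × t ⊆ setOf zs
  ⊆setOf⇒setOf {t = t} {w₀} ys tw₀ t⊆ys = map retract ys , zs⊆t , t⊆zs
    where
      retract : W → W
      retract v = if t v then v else w₀

      retract-∈ : ∀ v → T (t (retract v))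
      retract-∈ v with t v in eq
      ... | true  = subst T (sym eq) tt
      ... | false = tw₀

      retract-fix : ∀ v → T (t v) → retract v ≡ v
      retract-fix v with t v
      ... | true  = λ _ → refl
      ... | false = λ ()

      zs⊆t : setOf (map retract ys) ⊆ t
      zs⊆t w p with Any.satisfied (Anyₚ.map⁻ (to ∈-setOf p))
      ... | v , refl = retract-∈ v

      t⊆zs : t ⊆ setOf (map retract ys)
      t⊆zs w tw = from ∈-setOf (subst (_∈ map retract ys) (retract-fix w tw)
                                       (∈-map⁺ retract (to ∈-setOf (t⊆ys w tw))))

module Support (lem : LEM) {I W : Set} (M : PseudoModel I W) where
  open TupleSets lem {W}

  infix 3.5 _⊨_
  _⊨_ : Subset W → Fm I → Set
  s ⊨ φ = sup lem M s φ

  persistence : ∀ φ {s t} → t ⊆ s → s ⊨ φ → t ⊨ φ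
  persistence (var i)  t⊆s h w tw = h w (t⊆s w tw)
  persistence ⊥'       t⊆s h w tw = h w (t⊆s w tw)
  persistence (φ ∧' ψ) t⊆s (hφ , hψ) = persistence φ t⊆s hφ , persistence ψ t⊆s hψ
  persistence (φ ⇒' ψ) t⊆s h u u⊆t = h u (⊆-trans u⊆t t⊆s)
  persistence (φ ⩔ ψ)  t⊆s (inj₁ hφ) = inj₁ (persistence φ t⊆s hφ)
  persistence (φ ⩔ ψ)  t⊆s (inj₂ hψ) = inj₂ (persistence ψ t⊆s hψ)
  persistence (□ φ)    t⊆s h w tw = h w (t⊆s w tw)
  persistence (⊞ φ)    t⊆s h w tw = h w (t⊆s w tw)

  empty-support : ∀ φ {s} → (∀ w → ¬ T (s w)) → s ⊨ φ
  empty-support (var i)  empty w sw = ⊥-elim (empty w sw)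
  empty-support ⊥'       empty = empty
  empty-support (φ ∧' ψ) empty = empty-support φ empty , empty-support ψ empty
  empty-support (φ ⇒' ψ) empty t t⊆s _ = empty-support ψ (λ w tw → empty w (t⊆s w tw))
  empty-support (φ ⩔ ψ)  empty = inj₁ (empty-support φ empty)
  empty-support (□ φ)    empty w sw = ⊥-elim (empty w sw)
  empty-support (⊞ φ)    empty w sw = ⊥-elim (empty w sw)

  -- Tuples of length k enumerate, with repetitions, the subsets of size at most k.
  Coherent : Fm I → ℕ → Set
  Coherent φ k = ∀ s → (∀ (ys : Vec W k) → setOf ys ⊆ s → setOf ys ⊨ φ) → s ⊨ φ

  support-by-tuples : ∀ {φ k} → Coherent φ k → ∀ s →
    s ⊨ φ ⇔ (∀ (ys : Vec W k) → setOf ys ⊆ s → setOf ys ⊨ φ)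
  support-by-tuples {φ} C s = mk⇔ (λ h ys ys⊆s → persistence φ ys⊆s h) (C s)

  coherent-counterexample : ∀ {φ k s} → Coherent φ k → ¬ s ⊨ φ →
    ∃ λ (ys : Vec W k) → setOf ys ⊆ s × ¬ setOf ys ⊨ φ
  coherent-counterexample {φ} {k} {s} C ¬h with lem (∃ λ (ys : Vec W k) → setOf ys ⊆ s × ¬ setOf ys ⊨ φ)
  ... | yes c = c
  ... | no ¬c = ⊥-elim (¬h (C s λ ys ys⊆s → decidable-stable (lem _) λ ¬hys → ¬c (ys , ys⊆s , ¬hys)))

  coherent-pointwise : {Q : W → Set} (s : Subset W) →
    (∀ (ys : Vec W 1) → setOf ys ⊆ s → ∀ w → T (setOf ys w) → Q w) → ∀ w → T (s w) → Q w
  coherent-pointwise s H w sw = H (w ∷ []) singleton⊆s w (from ∈-setOf (here refl))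
    where
      singleton⊆s : setOf (w ∷ []) ⊆ s
      singleton⊆s v p with to ∈-setOf p
      ... | here refl = sw

  coherent-suc : ∀ {φ k} → Coherent φ (suc k) → Coherent φ (suc (suc k))
  coherent-suc {φ} C s H = C s duplicate-head
    where
      undup : ∀ {k w y} {ys : Vec W k} → w ∈ y ∷ y ∷ ys → w ∈ y ∷ ys
      undup (here e)  = here e
      undup (there p) = p

      duplicate-head : ∀ ys → setOf ys ⊆ s → setOf ys ⊨ φ
      duplicate-head (y ∷ ys) ys⊆s =
        persistence φ (setOf-mono there) (H (y ∷ y ∷ ys) (⊆-trans (setOf-mono undup) ys⊆s))

  coherent-≤ : ∀ {φ a b} → a ≤ b → Coherent φ (suc a) → Coherent φ (suc b)
  coherent-≤ {φ} {a} a≤b C = lift (≤⇒≤′ a≤b)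
    where
      lift : ∀ {b} → a ≤′ b → Coherent φ (suc b)
      lift ≤′-refl      = C
      lift (≤′-step p) = coherent-suc (lift p)

  coherent-∧ : ∀ {φ ψ k} → Coherent φ k → Coherent ψ k → Coherent (φ ∧' ψ) k
  coherent-∧ Cφ Cψ s H = Cφ s (λ ys ys⊆s → proj₁ (H ys ys⊆s)) , Cψ s (λ ys ys⊆s → proj₂ (H ys ys⊆s))

  coherent-⇒ : ∀ {φ ψ k} → Coherent ψ k → Coherent (φ ⇒' ψ) k
  coherent-⇒ {φ} C s H t t⊆s hφ =
    C t λ ys ys⊆t → H ys (⊆-trans ys⊆t t⊆s) (setOf ys) ⊆-refl (persistence φ ys⊆t hφ)

  coherent-⩔ : ∀ {φ ψ a b} → Coherent φ a → Coherent ψ b → Coherent (φ ⩔ ψ) (a + b)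
  coherent-⩔ {φ} {ψ} Cφ Cψ s H with lem (s ⊨ φ) | lem (s ⊨ ψ)
  ... | yes hφ | _      = inj₁ hφ
  ... | no _   | yes hψ = inj₂ hψ
  ... | no ¬hφ | no ¬hψ with coherent-counterexample Cφ ¬hφ | coherent-counterexample Cψ ¬hψ
  ... | ys , ys⊆s , ¬hys | zs , zs⊆s , ¬hzs =
    ⊥-elim ([ ¬hys ∘ persistence φ (setOf-mono ∈-++⁺ˡ) , ¬hzs ∘ persistence ψ (setOf-mono (∈-++⁺ʳ ys)) ]′
             (H (ys ++ᵛ zs) yzs⊆s))
    where
      yzs⊆s : setOf (ys ++ᵛ zs) ⊆ s
      yzs⊆s w p with Anyₚ.++⁻ ys (to ∈-setOf p)
      ... | inj₁ q = ys⊆s w (from ∈-setOf q)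
      ... | inj₂ q = zs⊆s w (from ∈-setOf q)

  fl-coherent : ∀ φ → Coherent φ (suc (fl φ))
  fl-coherent (var i)  = coherent-pointwise
  fl-coherent ⊥'       = coherent-pointwise
  fl-coherent (φ ∧' ψ) = coherent-∧ (coherent-≤ (m≤m⊔n (fl φ) (fl ψ)) (fl-coherent φ))
                                    (coherent-≤ (m≤n⊔m (fl φ) (fl ψ)) (fl-coherent ψ))
  fl-coherent (φ ⇒' ψ) = coherent-⇒ (fl-coherent ψ)
  fl-coherent (φ ⩔ ψ)  = subst (Coherent (φ ⩔ ψ) ∘ suc) (trans (+-suc (fl φ) (fl ψ)) (+-comm 1 _))
                               (coherent-⩔ (fl-coherent φ) (fl-coherent ψ))
  fl-coherent (□ φ)    = coherent-pointwise
  fl-coherent (⊞ φ)    = coherent-pointwise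

  ⇒-by-tuples : ∀ {φ ψ k} (zs : Vec W k) →
    setOf zs ⊨ φ ⇒' ψ ⇔ (∀ (ys : Vec W k) → setOf ys ⊆ setOf zs → setOf ys ⊨ φ → setOf ys ⊨ ψ)
  ⇒-by-tuples {φ} {ψ} zs = mk⇔ (λ h ys ys⊆zs → h (setOf ys) ys⊆zs) by-tuples
    where
      by-tuples : (∀ ys → setOf ys ⊆ setOf zs → setOf ys ⊨ φ → setOf ys ⊨ ψ) → setOf zs ⊨ φ ⇒' ψ
      by-tuples h t t⊆zs hφ with lem (∃ λ w → T (t w))
      ... | no ¬inhabited = empty-support ψ (λ w tw → ¬inhabited (w , tw))
      ... | yes (w₀ , tw₀) with ⊆setOf⇒setOf zs tw₀ t⊆zs
      ... | ys , ys⊆t , t⊆ys = persistence ψ t⊆ys (h ys (⊆-trans ys⊆t t⊆zs) (persistence φ ys⊆t hφ))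

module Satisfaction {I W : Set} (𝔐 : RelModel I W) where
  open RelModel 𝔐 using (S; ε; E)

  infix 3.5 _⊩_
  _⊩_ : ∀ {Γ} → Env 𝔐 Γ → FO I Γ → Set
  ρ ⊩ φ = ⟦ 𝔐 ⟧ φ ρ

  infixl 5 _▸⋆_
  _▸⋆_ : ∀ {Γ τ k} → Env 𝔐 Γ → Vec (Dom 𝔐 τ) k → Env 𝔐 (replicate k τ ++ Γ)
  ρ ▸⋆ []       = ρ
  ρ ▸⋆ (d ∷ ds) = _▸_ 𝔐 (ρ ▸⋆ ds) d

  ⟦∀̇ⁿ⟧ : ∀ {Γ τ} k (φ : FO I (replicate k τ ++ Γ)) (ρ : Env 𝔐 Γ) →
    ρ ⊩ ∀̇ⁿ k τ φ ⇔ (∀ ds → ρ ▸⋆ ds ⊩ φ)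
  ⟦∀̇ⁿ⟧ 0       φ ρ = mk⇔ (λ { h [] → h }) (λ h → h [])
  ⟦∀̇ⁿ⟧ {τ = τ} (suc k) φ ρ =
    mk⇔ (λ { h (d ∷ ds) → to (⟦∀̇ⁿ⟧ k (∀̇ τ φ) ρ) h ds d })
        (λ h → from (⟦∀̇ⁿ⟧ k (∀̇ τ φ) ρ) (λ ds d → h (d ∷ ds)))

  ▸⋆-wkN : ∀ {Γ τ σ k} (ρ : Env 𝔐 Γ) (ds : Vec (Dom 𝔐 τ) k) (x : Var Γ σ) → (ρ ▸⋆ ds) (wkN k τ x) ≡ ρ x
  ▸⋆-wkN ρ []       x = refl
  ▸⋆-wkN {τ = τ} ρ (d ∷ ds) x = ▸⋆-wkN {τ = τ} ρ ds x

  map-▸⋆-wkN : ∀ {Γ τ σ k n} (ρ : Env 𝔐 Γ) (ds : Vec (Dom 𝔐 τ) k) (xs : Vec (Var Γ σ) n) →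
    map (ρ ▸⋆ ds) (map (wkN k τ) xs) ≡ map ρ xs
  map-▸⋆-wkN {τ = τ} ρ ds xs = trans (sym (map-∘ (ρ ▸⋆ ds) (wkN _ τ) xs)) (map-cong (▸⋆-wkN {τ = τ} ρ ds) xs)

  map-▸⋆-fresh : ∀ {Γ τ k} (ρ : Env 𝔐 Γ) (ds : Vec (Dom 𝔐 τ) k) → map (ρ ▸⋆ ds) (fresh k τ) ≡ ds
  map-▸⋆-fresh ρ [] = refl
  map-▸⋆-fresh {τ = τ} {k = suc k} ρ (d ∷ ds) =
    cong (d ∷_) (trans (sym (map-∘ (ρ ▸⋆ (d ∷ ds)) vs (fresh k τ))) (map-▸⋆-fresh ρ ds))

  ⟦⋀⟧ : ∀ {Γ n} (φs : Vec (FO I Γ) (suc n)) (ρ : Env 𝔐 Γ) → ρ ⊩ ⋀ φs ⇔ All (ρ ⊩_) φs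
  ⟦⋀⟧ (φ ∷ [])     ρ = mk⇔ (_∷ []) All.head
  ⟦⋀⟧ (φ ∷ ψ ∷ φs) ρ = mk⇔ (λ (h , hs) → h ∷ to (⟦⋀⟧ (ψ ∷ φs) ρ) hs)
                           (λ { (h ∷ hs) → h , from (⟦⋀⟧ (ψ ∷ φs) ρ) hs })

  ⟦⋁⟧ : ∀ {Γ n} (φs : Vec (FO I Γ) (suc n)) (ρ : Env 𝔐 Γ) → ρ ⊩ ⋁ φs ⇔ Any (ρ ⊩_) φs
  ⟦⋁⟧ (φ ∷ [])     ρ = mk⇔ here (λ { (here h) → h ; (there ()) })
  ⟦⋁⟧ (φ ∷ ψ ∷ φs) ρ = mk⇔ [ here , there ∘ to (⟦⋁⟧ (ψ ∷ φs) ρ) ]′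
                           (λ { (here h) → inj₁ h ; (there h) → inj₂ (from (⟦⋁⟧ (ψ ∷ φs) ρ) h) })

  ⟦⋀map⟧ : ∀ {Γ n} {A : Set} (f : A → FO I Γ) (xs : Vec A (suc n)) (ρ : Env 𝔐 Γ) →
    ρ ⊩ ⋀ (map f xs) ⇔ All (λ x → ρ ⊩ f x) xs
  ⟦⋀map⟧ f xs ρ = ⇔-trans (⟦⋀⟧ (map f xs) ρ) All-map⇔

  ⟦⋁map⟧ : ∀ {Γ n} {A : Set} (f : A → FO I Γ) (xs : Vec A (suc n)) (ρ : Env 𝔐 Γ) →
    ρ ⊩ ⋁ (map f xs) ⇔ Any (λ x → ρ ⊩ f x) xs
  ⟦⋁map⟧ f xs ρ = ⇔-trans (⟦⋁⟧ (map f xs) ρ) Any-map⇔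

  σ-witness : W → W → S → Set
  σ-witness w v a = E w a × ε v a

  ⟦⋀-guards⟧ : ∀ {Γ n} (ρ : Env 𝔐 Γ) (x : Var Γ 𝕨) (ys : Vec (Var Γ 𝕨) (suc n)) (μs : Vec (Var Γ 𝕤) (suc n)) →
    ρ ⊩ ⋀ (zipWith (λ y μ → Ė x μ ∧̇ (y ∈̇ μ)) ys μs) ⇔ Pointwise (σ-witness (ρ x)) (map ρ ys) (map ρ μs)
  ⟦⋀-guards⟧ ρ x (y ∷ [])     (μ ∷ [])      = mk⇔ (_∷ []) (λ { (g ∷ []) → g })
  ⟦⋀-guards⟧ ρ x (y ∷ y′ ∷ ys) (μ ∷ μ′ ∷ μs) =
    mk⇔ (λ (g , gs) → g ∷ to (⟦⋀-guards⟧ ρ x (y′ ∷ ys) (μ′ ∷ μs)) gs)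
        (λ { (g ∷ gs) → g , from (⟦⋀-guards⟧ ρ x (y′ ∷ ys) (μ′ ∷ μs)) gs })

module Translation (lem : LEM) {I W : Set} (M : PseudoModel I W) (𝔐 : RelModel I W)
                   {s₀ : Subset W} (R : Representation M s₀ 𝔐) where
  open PseudoModel M using (Σₘ)
  open RelModel 𝔐 using (S; ε; E)
  open Representation R
  open TupleSets lem
  open Support lem M
  open Satisfaction 𝔐

  σ-code : ∀ w v → T (σ lem M w v) ⇔ ∃ (σ-witness w v)
  σ-code w v = ⇔-trans (T-does (lem _)) (mk⇔ witness member)
    where
      witness : (∃ λ t → Σₘ w t × T (t v)) → ∃ (σ-witness w v)
      witness (t , wt , vt) with Σ⊆S w t wt
      ... | a , refl = a , from (E-code w a) wt , from (ε-code v a) vt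
      member : ∃ (σ-witness w v) → ∃ λ t → Σₘ w t × T (t v)
      member (a , e , m) = code a , to (E-code w a) e , to (ε-code v a) m

  ⊆σ⇔Pointwise : ∀ {k} w (ys : Vec W k) → setOf ys ⊆ σ lem M w ⇔ ∃ (Pointwise (σ-witness w) ys)
  ⊆σ⇔Pointwise w ys = ⇔-trans (⇔-sym All⇔∀setOf) (⇔-trans (All-⇔ (σ-code w)) All-∃⇔∃-Pointwise)

  □-by-tuples : ∀ φ w → σ lem M w ⊨ φ ⇔
    (∀ (ys : Vec W (suc (fl φ))) as → Pointwise (σ-witness w) ys as → setOf ys ⊨ φ)
  □-by-tuples φ w = ⇔-trans (support-by-tuples (fl-coherent φ) _) (Π-⇔ λ ys →
    mk⇔ (λ h as pw → h (from (⊆σ⇔Pointwise w ys) (as , pw)))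
        (λ h ys⊆σ → uncurry h (to (⊆σ⇔Pointwise w ys) ys⊆σ)))

  ⊞-by-codes : ∀ φ w → (∀ t → Σₘ w t → t ⊨ φ) ⇔ (∀ a → Σₘ w (code a) → code a ⊨ φ)
  ⊞-by-codes φ w = mk⇔ (λ h a → h (code a)) by-codes
    where
      by-codes : (∀ a → Σₘ w (code a) → code a ⊨ φ) → ∀ t → Σₘ w t → t ⊨ φ
      by-codes h t wt with Σ⊆S w t wt
      ... | a , refl = h a wt

  Translates : Fm I → Set
  Translates φ = ∀ {Γ n} (xs : Vec (Var Γ 𝕨) (suc n)) (ρ : Env 𝔐 Γ) → ρ ⊩ ST φ xs ⇔ setOf (map ρ xs) ⊨ φ

  translates-at : ∀ {φ Γ n} → Translates φ → {xs : Vec (Var Γ 𝕨) (suc n)} {ρ : Env 𝔐 Γ} {ys : Vec W (suc n)} →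
    map ρ xs ≡ ys → ρ ⊩ ST φ xs ⇔ setOf ys ⊨ φ
  translates-at Tφ refl = Tφ _ _

  ⟦⋀map⟧⇔∀setOf : ∀ {Γ n} {Q : W → Set} (f : Var Γ 𝕨 → FO I Γ) (xs : Vec (Var Γ 𝕨) (suc n)) (ρ : Env 𝔐 Γ) →
    (∀ x → ρ ⊩ f x ⇔ Q (ρ x)) → ρ ⊩ ⋀ (map f xs) ⇔ (∀ w → T (setOf (map ρ xs) w) → Q w)
  ⟦⋀map⟧⇔∀setOf f xs ρ h =
    ⇔-trans (⟦⋀map⟧ f xs ρ) (⇔-trans (All-⇔ h) (⇔-trans (⇔-sym All-map⇔) All⇔∀setOf))

  ⟦tuple⊆⟧ : ∀ {Γ k} (xs : Vec (Var Γ 𝕨) (suc k)) (ρ : Env 𝔐 Γ) (ds : Vec W (suc k)) →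
    ρ ▸⋆ ds ⊩ ⋀ (map (λ y → ⋁ (map (λ x → y ≐ wkN (suc k) 𝕨 x) xs)) (fresh (suc k) 𝕨))
      ⇔ setOf ds ⊆ setOf (map ρ xs)
  ⟦tuple⊆⟧ {Γ} {k} xs ρ ds =
    subst (λ zs → ρ ▸⋆ ds ⊩ ⋀ (map value-of-xs (fresh (suc k) 𝕨)) ⇔ setOf zs ⊆ setOf (map ρ xs))
          (map-▸⋆-fresh ρ ds)
          (⟦⋀map⟧⇔∀setOf value-of-xs (fresh (suc k) 𝕨) (ρ ▸⋆ ds) ⟦value-of-xs⟧)
    where
      value-of-xs : Var (replicate (suc k) 𝕨 ++ Γ) 𝕨 → FO I (replicate (suc k) 𝕨 ++ Γ)
      value-of-xs y = ⋁ (map (λ x → y ≐ wkN (suc k) 𝕨 x) xs)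

      ⟦value-of-xs⟧ : ∀ y → ρ ▸⋆ ds ⊩ value-of-xs y ⇔ T (setOf (map ρ xs) ((ρ ▸⋆ ds) y))
      ⟦value-of-xs⟧ y =
        ⇔-trans (⟦⋁map⟧ (λ x → y ≐ wkN (suc k) 𝕨 x) xs (ρ ▸⋆ ds))
       (⇔-trans (Any-⇔ λ x → let e = ▸⋆-wkN {τ = 𝕨} ρ ds x in mk⇔ (λ p → trans p e) (λ p → trans p (sym e)))
       (⇔-trans (⇔-sym Any-map⇔) (⇔-sym ∈-setOf)))

  ⟦tuple∈⟧ : ∀ {Γ} (l : Var Γ 𝕤) (ρ : Env 𝔐 Γ) {k} (ds : Vec W (suc k)) →
    ρ ▸⋆ ds ⊩ ⋀ (map (λ x → x ∈̇ wkN (suc k) 𝕨 l) (fresh (suc k) 𝕨)) ⇔ setOf ds ⊆ code (ρ l)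
  ⟦tuple∈⟧ {Γ} l ρ {k} ds =
    subst (λ zs → ρ ▸⋆ ds ⊩ ⋀ (map in-l (fresh (suc k) 𝕨)) ⇔ setOf zs ⊆ code (ρ l))
          (map-▸⋆-fresh ρ ds)
          (⟦⋀map⟧⇔∀setOf in-l (fresh (suc k) 𝕨) (ρ ▸⋆ ds) λ x →
            subst (λ a → ε ((ρ ▸⋆ ds) x) a ⇔ T (code (ρ l) ((ρ ▸⋆ ds) x)))
                  (sym (▸⋆-wkN {τ = 𝕨} ρ ds l)) (ε-code _ _))
    where
      in-l : Var (replicate (suc k) 𝕨 ++ Γ) 𝕨 → FO I (replicate (suc k) 𝕨 ++ Γ)
      in-l x = x ∈̇ wkN (suc k) 𝕨 l

  translates-var : ∀ i → Translates (var i)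
  translates-var i xs ρ = ⟦⋀map⟧⇔∀setOf (Ṗ i) xs ρ (λ x → P-code i (ρ x))

  translates-⊥ : Translates ⊥'
  translates-⊥ xs ρ = ⟦⋀map⟧⇔∀setOf _ xs ρ (λ _ → mk⇔ (λ x≢x → x≢x refl) ⊥-elim)

  translates-∧ : ∀ {φ ψ} → Translates φ → Translates ψ → Translates (φ ∧' ψ)
  translates-∧ Tφ Tψ xs ρ = Tφ xs ρ ×-⇔ Tψ xs ρ

  translates-⩔ : ∀ {φ ψ} → Translates φ → Translates ψ → Translates (φ ⩔ ψ)
  translates-⩔ Tφ Tψ xs ρ = Tφ xs ρ ⊎-⇔ Tψ xs ρ

  translates-⇒ : ∀ {φ ψ} → Translates φ → Translates ψ → Translates (φ ⇒' ψ)
  translates-⇒ Tφ Tψ {n = n} xs ρ =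
    ⇔-trans (⟦∀̇ⁿ⟧ (suc n) _ ρ)
   (⇔-trans (Π-⇔ λ ds → →-cong-⇔ (⟦tuple⊆⟧ xs ρ ds)
                          (→-cong-⇔ (translates-at Tφ (map-▸⋆-fresh ρ ds))
                                    (translates-at Tψ (map-▸⋆-fresh ρ ds))))
            (⇔-sym (⇒-by-tuples (map ρ xs))))

  translates-□ : ∀ {φ} → Translates φ → Translates (□ φ)
  translates-□ {φ} Tφ {Γ} xs ρ = ⟦⋀map⟧⇔∀setOf _ xs ρ λ x → ⇔-trans (⟦box⟧ x) (⇔-sym (□-by-tuples φ (ρ x)))
    where
      m : ℕ
      m = suc (fl φ)

      Δ : Ctx
      Δ = replicate m 𝕤 ++ (replicate m 𝕨 ++ Γ)

      ws : Vec (Var Δ 𝕨) m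
      ws = map (wkN m 𝕤) (fresh m 𝕨)

      ws-values : ∀ ys as → map (ρ ▸⋆ ys ▸⋆ as) ws ≡ ys
      ws-values ys as = trans (map-▸⋆-wkN (ρ ▸⋆ ys) as (fresh m 𝕨)) (map-▸⋆-fresh ρ ys)

      guard : Var Γ 𝕨 → FO I Δ
      guard x = ⋀ (zipWith (λ y μ → Ė (wkN m 𝕤 (wkN m 𝕨 x)) μ ∧̇ (y ∈̇ μ)) ws (fresh m 𝕤))

      ⟦guard⟧ : ∀ x ys as → ρ ▸⋆ ys ▸⋆ as ⊩ guard x ⇔ Pointwise (σ-witness (ρ x)) ys as
      ⟦guard⟧ x ys as = subst (λ R′ → ρ ▸⋆ ys ▸⋆ as ⊩ guard x ⇔ R′)
        (trans (cong (λ w → Pointwise (σ-witness w) _ _)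
                     (trans (▸⋆-wkN {τ = 𝕤} (ρ ▸⋆ ys) as _) (▸⋆-wkN {τ = 𝕨} ρ ys x)))
               (cong₂ (Pointwise (σ-witness (ρ x))) (ws-values ys as) (map-▸⋆-fresh (ρ ▸⋆ ys) as)))
        (⟦⋀-guards⟧ (ρ ▸⋆ ys ▸⋆ as) _ ws (fresh m 𝕤))

      ⟦box⟧ : ∀ x → ρ ⊩ ∀̇ⁿ m 𝕨 (∀̇ⁿ m 𝕤 (guard x →̇ ST φ ws))
                      ⇔ (∀ ys as → Pointwise (σ-witness (ρ x)) ys as → setOf ys ⊨ φ)
      ⟦box⟧ x = ⇔-trans (⟦∀̇ⁿ⟧ m _ ρ) (Π-⇔ λ ys → ⇔-trans (⟦∀̇ⁿ⟧ m _ (ρ ▸⋆ ys)) (Π-⇔ λ as →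
        →-cong-⇔ (⟦guard⟧ x ys as) (translates-at Tφ (ws-values ys as))))

  star-correct : ∀ {φ Γ} → Translates φ → (l : Var Γ 𝕤) (ρ : Env 𝔐 Γ) → ρ ⊩ star φ l ⇔ code (ρ l) ⊨ φ
  star-correct {φ} Tφ l ρ =
    ⇔-trans (⟦∀̇ⁿ⟧ (suc (fl φ)) _ ρ)
   (⇔-trans (Π-⇔ λ ds → →-cong-⇔ (⟦tuple∈⟧ l ρ ds) (translates-at Tφ (map-▸⋆-fresh ρ ds)))
            (⇔-sym (support-by-tuples (fl-coherent φ) _)))

  translates-⊞ : ∀ {φ} → Translates φ → Translates (⊞ φ)
  translates-⊞ {φ} Tφ xs ρ = ⟦⋀map⟧⇔∀setOf _ xs ρ λ x →
    ⇔-trans (Π-⇔ λ a → →-cong-⇔ (E-code (ρ x) a) (star-correct Tφ vz (_▸_ 𝔐 ρ a)))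
            (⇔-sym (⊞-by-codes φ (ρ x)))

  translates : ∀ φ → Translates φ
  translates (var i)  = translates-var i
  translates ⊥'       = translates-⊥
  translates (φ ∧' ψ) = translates-∧ (translates φ) (translates ψ)
  translates (φ ⇒' ψ) = translates-⇒ (translates φ) (translates ψ)
  translates (φ ⩔ ψ)  = translates-⩔ (translates φ) (translates ψ)
  translates (□ φ)    = translates-□ (translates φ)
  translates (⊞ φ)    = translates-⊞ (translates φ)

proposition3p10 : (lem : LEM) {I W : Set} (M : PseudoModel I W) (φ : Fm I)
    (s : Subset W) (𝔐 : RelModel I W) (R : Representation M s 𝔐)
    (a : RelModel.S 𝔐) → Representation.code R a ≡ s →
    (sup lem M s φ ⇔ ⟦ 𝔐 ⟧ (star φ vz) ([λ↦_] 𝔐 a))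
proposition3p10 lem M φ s 𝔐 R a code-a≡s =
  subst (λ t → sup lem M t φ ⇔ _) code-a≡s (⇔-sym (star-correct (translates φ) vz ([λ↦_] 𝔐 a)))
  where open Translation lem M 𝔐 R
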